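{- Let $q:\mathbb{E}\to\mathbb{B}$ be a locally small Grothendieck fibration, with $\mathbb{B}$ locally cartesian closed. Let $J$ be an object of $\mathbb{B}$, let $B\in\mathbb{E}_K$ be tiny relative to $J$, and let $B'\to B$ be a cartesian map lying over $\sigma:I\to K$ (so $B'\in\mathbb{E}_I$). Then $B'$ is also tiny relative to $J$.
   Context: Local smallness: for $A\in\mathbb{E}_I$, $X\in\mathbb{E}_J$ there is an object $\hom(A,X)\to I\times J$ of $\mathbb{B}$ such that for $\tau:L\to I\times J$, maps $L\to\hom(A,X)$ over $I\times J$ correspond naturally to vertical maps $(\pi_0\tau)^\ast A\to(\pi_1\tau)^\ast X$ in $\mathbb{E}_L$. An object $B\in\mathbb{E}_K$ is tiny relative to $J$ if the functor $\mathbb{E}_J\to\mathbb{B}/(K\times J)$, $X\mapsto\hom(B,X)$, has a right adjoint. -}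

module Defs where

open import Level using (Level; _⊔_) renaming (suc to lsuc)
open import Relation.Binary.PropositionalEquality
open import Data.Product using (Σ; Σ-syntax; _,_; proj₁; proj₂; _×_)
open import Function.Bundles using (_↔_; Inverse)

private
  variable
    o ℓ o' ℓ' o₁ ℓ₁ o₂ ℓ₂ : Level

-- Uniqueness of identity proofs (axiom K is on by default in Agda).
uip′ : ∀ {a} {A : Set a} {x y : A} (p q : x ≡ y) → p ≡ q
uip′ refl refl = refl

-- Categories (hom-equality is propositional equality)

record Category (o ℓ : Level) : Set (lsuc (o ⊔ ℓ)) where
  infixr 9 _∘_
  field
    Obj   : Set o
    Hom   : Obj → Obj → Set ℓ
    id    : ∀ {A} → Hom A A
    _∘_   : ∀ {A B C} → Hom B C → Hom A B → Hom A C
    idˡ   : ∀ {A B} (f : Hom A B) → id ∘ f ≡ f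
    idʳ   : ∀ {A B} (f : Hom A B) → f ∘ id ≡ f
    assoc : ∀ {A B C D} (h : Hom C D) (g : Hom B C) (f : Hom A B) →
            (h ∘ g) ∘ f ≡ h ∘ (g ∘ f)

record Functor (C : Category o₁ ℓ₁) (D : Category o₂ ℓ₂)
       : Set (o₁ ⊔ ℓ₁ ⊔ o₂ ⊔ ℓ₂) where
  private
    module C = Category C
    module D = Category D
  field
    F₀   : C.Obj → D.Obj
    F₁   : ∀ {A B} → C.Hom A B → D.Hom (F₀ A) (F₀ B)
    F-id : ∀ {A} → F₁ (C.id {A}) ≡ D.id
    F-∘  : ∀ {A B E} (g : C.Hom B E) (f : C.Hom A B) →
           F₁ (g C.∘ f) ≡ F₁ g D.∘ F₁ f

record RightAdjoint {C : Category o₁ ℓ₁} {D : Category o₂ ℓ₂}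
       (F : Functor C D) : Set (o₁ ⊔ ℓ₁ ⊔ o₂ ⊔ ℓ₂) where
  private
    module C = Category C
    module D = Category D
    module F = Functor F
  field
    G : Functor D C
  private module G = Functor G
  field
    η     : ∀ X → C.Hom X (G.F₀ (F.F₀ X))
    ε     : ∀ Y → D.Hom (F.F₀ (G.F₀ Y)) Y
    η-nat : ∀ {X X'} (f : C.Hom X X') →
            G.F₁ (F.F₁ f) C.∘ η X ≡ η X' C.∘ f
    ε-nat : ∀ {Y Y'} (g : D.Hom Y Y') →
            g D.∘ ε Y ≡ ε Y' D.∘ F.F₁ (G.F₁ g)
    zig   : ∀ X → ε (F.F₀ X) D.∘ F.F₁ (η X) ≡ D.id
    zag   : ∀ Y → G.F₁ (ε Y) C.∘ η (G.F₀ Y) ≡ C.id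

module _ (C : Category o ℓ) where
  open Category C

  record Terminal : Set (o ⊔ ℓ) where
    field
      ⊤      : Obj
      !      : ∀ {A} → Hom A ⊤
      !-uniq : ∀ {A} (f : Hom A ⊤) → f ≡ !

  record Product (A B : Obj) : Set (o ⊔ ℓ) where
    field
      A×B    : Obj
      π₀     : Hom A×B A
      π₁     : Hom A×B B
      ⟨_,_⟩  : ∀ {Z} → Hom Z A → Hom Z B → Hom Z A×B
      β₀     : ∀ {Z} (f : Hom Z A) (g : Hom Z B) → π₀ ∘ ⟨ f , g ⟩ ≡ f
      β₁     : ∀ {Z} (f : Hom Z A) (g : Hom Z B) → π₁ ∘ ⟨ f , g ⟩ ≡ g
      ⟨⟩-uniq : ∀ {Z} (f : Hom Z A) (g : Hom Z B) (h : Hom Z A×B) →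
               π₀ ∘ h ≡ f → π₁ ∘ h ≡ g → h ≡ ⟨ f , g ⟩

  BinaryProducts : Set (o ⊔ ℓ)
  BinaryProducts = ∀ A B → Product A B

  record Pullback {A B E : Obj} (f : Hom A E) (g : Hom B E) : Set (o ⊔ ℓ) where
    field
      P        : Obj
      p₁       : Hom P A
      p₂       : Hom P B
      commute  : f ∘ p₁ ≡ g ∘ p₂
      universal : ∀ {Z} (x : Hom Z A) (y : Hom Z B) → f ∘ x ≡ g ∘ y → Hom Z P
      βp₁      : ∀ {Z} (x : Hom Z A) (y : Hom Z B) (e : f ∘ x ≡ g ∘ y) →
                 p₁ ∘ universal x y e ≡ x
      βp₂      : ∀ {Z} (x : Hom Z A) (y : Hom Z B) (e : f ∘ x ≡ g ∘ y) →
                 p₂ ∘ universal x y e ≡ y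
      uniq     : ∀ {Z} (x : Hom Z A) (y : Hom Z B) (e : f ∘ x ≡ g ∘ y)
                 (h : Hom Z P) → p₁ ∘ h ≡ x → p₂ ∘ h ≡ y → h ≡ universal x y e

  Pullbacks : Set (o ⊔ ℓ)
  Pullbacks = ∀ {A B E} (f : Hom A E) (g : Hom B E) → Pullback f g

module _ (C : Category o ℓ) where
  open Category C

  record SliceObj (X : Obj) : Set (o ⊔ ℓ) where
    constructor sliceObj
    field
      dom : Obj
      arr : Hom dom X
  open SliceObj public

  SliceHom : ∀ {X} → SliceObj X → SliceObj X → Set ℓ
  SliceHom {X} A B = Σ[ h ∈ Hom (dom A) (dom B) ] (arr B ∘ h ≡ arr A)

  private
    Σ≡ : ∀ {X} {A B : SliceObj X} {f g : SliceHom A B} →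
         proj₁ f ≡ proj₁ g → f ≡ g
    Σ≡ {f = h , p} {g = .h , q} refl = cong (h ,_) (uip′ p q)

  Slice : Obj → Category (o ⊔ ℓ) ℓ
  Slice X = record
    { Obj   = SliceObj X
    ; Hom   = SliceHom
    ; id    = λ {A} → id , idʳ (arr A)
    ; _∘_   = λ {A} {B} {E} g f →
                proj₁ g ∘ proj₁ f
              , trans (sym (assoc (arr E) (proj₁ g) (proj₁ f)))
                      (trans (cong (_∘ proj₁ f) (proj₂ g)) (proj₂ f))
    ; idˡ   = λ f → Σ≡ (idˡ (proj₁ f))
    ; idʳ   = λ f → Σ≡ (idʳ (proj₁ f))
    ; assoc = λ h g f → Σ≡ (assoc (proj₁ h) (proj₁ g) (proj₁ f))
    }

  pullbackFunctor : Pullbacks C → ∀ {X Y} (f : Hom X Y) →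
                    Functor (Slice Y) (Slice X)
  pullbackFunctor pb {X} {Y} f = record
    { F₀   = λ A → sliceObj (Pullback.P (pb (arr A) f)) (Pullback.p₂ (pb (arr A) f))
    ; F₁   = F₁
    ; F-id = λ {A} → Σ≡ (sym (Pullback.uniq (pb (arr A) f) _ _ _ id
                          (trans (idʳ _) (sym (idˡ _))) (idʳ _)))
    ; F-∘  = λ {A} {B} {E} g h → Σ≡ (F∘ {A} {B} {E} g h)
    }
    where
      module PB (A : SliceObj Y) = Pullback (pb (arr A) f)
      sq : ∀ {A B} (h : SliceHom A B) →
           arr B ∘ (proj₁ h ∘ PB.p₁ A) ≡ f ∘ PB.p₂ A
      sq {A} {B} (h , e) = trans (sym (assoc (arr B) h (PB.p₁ A)))
                           (trans (cong (_∘ PB.p₁ A) e) (PB.commute A))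
      F₁ : ∀ {A B} → SliceHom A B →
           SliceHom (sliceObj (PB.P A) (PB.p₂ A)) (sliceObj (PB.P B) (PB.p₂ B))
      F₁ {A} {B} h = PB.universal B (proj₁ h ∘ PB.p₁ A) (PB.p₂ A) (sq h)
                   , PB.βp₂ B _ _ _
      F∘ : ∀ {A B E} (g : SliceHom B E) (h : SliceHom A B) →
           proj₁ (F₁ {A} {E} (proj₁ g ∘ proj₁ h
                  , trans (sym (assoc (arr E) (proj₁ g) (proj₁ h)))
                          (trans (cong (_∘ proj₁ h) (proj₂ g)) (proj₂ h))))
           ≡ proj₁ (F₁ g) ∘ proj₁ (F₁ h)
      F∘ {A} {B} {E} g h = sym (PB.uniq E _ _ _ _ e₁ e₂)
        where
          e₁ : PB.p₁ E ∘ (proj₁ (F₁ g) ∘ proj₁ (F₁ h)) ≡ (proj₁ g ∘ proj₁ h) ∘ PB.p₁ A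
          e₁ = trans (sym (assoc _ _ _))
               (trans (cong (_∘ proj₁ (F₁ h)) (PB.βp₁ E _ _ _))
               (trans (assoc _ _ _)
               (trans (cong (proj₁ g ∘_) (PB.βp₁ B _ _ _))
                      (sym (assoc _ _ _)))))
          e₂ : PB.p₂ E ∘ (proj₁ (F₁ g) ∘ proj₁ (F₁ h)) ≡ PB.p₂ A
          e₂ = trans (sym (assoc _ _ _))
               (trans (cong (_∘ proj₁ (F₁ h)) (PB.βp₂ E _ _ _)) (PB.βp₂ B _ _ _))

record LCCC (C : Category o ℓ) : Set (o ⊔ ℓ) where
  open Category C
  field
    terminal  : Terminal C
    products  : BinaryProducts C
    pullbacks : Pullbacks C
    Π         : ∀ {X Y} (f : Hom X Y) → RightAdjoint (pullbackFunctor C pullbacks f)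

-- Fibrations, presented as displayed categories over the base

record Displayed (B : Category o ℓ) (o' ℓ' : Level) : Set (o ⊔ ℓ ⊔ lsuc (o' ⊔ ℓ')) where
  open Category B
  infixr 9 _∘'_
  field
    Ob[_]  : Obj → Set o'
    Hom[_] : ∀ {I J} → Hom I J → Ob[ I ] → Ob[ J ] → Set ℓ'
    id'    : ∀ {I} {X : Ob[ I ]} → Hom[ id ] X X
    _∘'_   : ∀ {I J K} {f : Hom J K} {g : Hom I J}
             {X : Ob[ I ]} {Y : Ob[ J ]} {Z : Ob[ K ]} →
             Hom[ f ] Y Z → Hom[ g ] X Y → Hom[ f ∘ g ] X Z
    idˡ'   : ∀ {I J} {f : Hom I J} {X Y} (f' : Hom[ f ] X Y) →
             subst (λ h → Hom[ h ] X Y) (idˡ f) (id' ∘' f') ≡ f'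
    idʳ'   : ∀ {I J} {f : Hom I J} {X Y} (f' : Hom[ f ] X Y) →
             subst (λ h → Hom[ h ] X Y) (idʳ f) (f' ∘' id') ≡ f'
    assoc' : ∀ {I J K L} {h : Hom K L} {g : Hom J K} {f : Hom I J}
             {W X Y Z} (h' : Hom[ h ] Y Z) (g' : Hom[ g ] X Y) (f' : Hom[ f ] W X) →
             subst (λ k → Hom[ k ] W Z) (assoc h g f) ((h' ∘' g') ∘' f')
             ≡ h' ∘' (g' ∘' f')

  _≡[_]_ : ∀ {I J} {f g : Hom I J} {X Y} → Hom[ f ] X Y → f ≡ g → Hom[ g ] X Y → Set ℓ'
  _≡[_]_ {X = X} {Y = Y} f' p g' = subst (λ h → Hom[ h ] X Y) p f' ≡ g'

  IsCartesian : ∀ {I J} {f : Hom J I} {Y : Ob[ J ]} {X : Ob[ I ]} →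
                Hom[ f ] Y X → Set (o ⊔ ℓ ⊔ o' ⊔ ℓ')
  IsCartesian {J = J} {f = f} {Y = Y} {X = X} φ =
    ∀ {L} (g : Hom L J) {Z : Ob[ L ]} (ψ : Hom[ f ∘ g ] Z X) →
    Σ[ χ ∈ Hom[ g ] Z Y ] ((φ ∘' χ ≡ ψ) ×
      (∀ (χ' : Hom[ g ] Z Y) → φ ∘' χ' ≡ ψ → χ' ≡ χ))

  Fibre : Obj → Category o' ℓ'
  Fibre I = record
    { Obj   = Ob[ I ]
    ; Hom   = Hom[ id ]
    ; id    = id'
    ; _∘_   = λ g f → subst (λ h → Hom[ h ] _ _) (idˡ id) (g ∘' f)
    ; idˡ   = λ f → idˡ' f
    ; idʳ   = λ f → trans (cong (λ p → subst (λ h → Hom[ h ] _ _) p (f ∘' id'))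
                                (uip′ (idˡ id) (idʳ id))) (idʳ' f)
    ; assoc = λ h g f → vassoc h g f
    }
    where
      substˡ : ∀ {I J K} {f f₁ : Hom J K} {g : Hom I J} {X Y Z}
               (p : f ≡ f₁) (f' : Hom[ f ] Y Z) (g' : Hom[ g ] X Y) →
               subst (λ h → Hom[ h ] X Z) (cong (_∘ g) p) (f' ∘' g')
               ≡ subst (λ h → Hom[ h ] Y Z) p f' ∘' g'
      substˡ refl f' g' = refl
      substʳ : ∀ {I J K} {f : Hom J K} {g g₁ : Hom I J} {X Y Z}
               (p : g ≡ g₁) (f' : Hom[ f ] Y Z) (g' : Hom[ g ] X Y) →
               subst (λ h → Hom[ h ] X Z) (cong (f ∘_) p) (f' ∘' g')
               ≡ f' ∘' subst (λ h → Hom[ h ] X Y) p g'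
      substʳ refl f' g' = refl
      substsubst : ∀ {I J} {a b c : Hom I J} {X Y} (p : a ≡ b) (q : b ≡ c) (x : Hom[ a ] X Y) →
                   subst (λ h → Hom[ h ] X Y) q (subst (λ h → Hom[ h ] X Y) p x)
                   ≡ subst (λ h → Hom[ h ] X Y) (trans p q) x
      substsubst refl refl x = refl
      substirr : ∀ {I J} {a b : Hom I J} {X Y} (p q : a ≡ b) (x : Hom[ a ] X Y) →
                 subst (λ h → Hom[ h ] X Y) p x ≡ subst (λ h → Hom[ h ] X Y) q x
      substirr p q x = cong (λ r → subst (λ h → Hom[ h ] _ _) r x) (uip′ p q)
      vassoc : ∀ {X Y Z W} (h' : Hom[ id ] Z W) (g' : Hom[ id ] Y Z) (f' : Hom[ id ] X Y) →
               subst (λ k → Hom[ k ] X W) (idˡ id)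
                 (subst (λ k → Hom[ k ] Y W) (idˡ id) (h' ∘' g') ∘' f')
               ≡ subst (λ k → Hom[ k ] X W) (idˡ id)
                 (h' ∘' subst (λ k → Hom[ k ] X Z) (idˡ id) (g' ∘' f'))
      vassoc {X} {Y} {Z} {W} h' g' f' =
        trans (cong (subst HW i) (sym (substˡ i (h' ∘' g') f')))
        (trans (substsubst (cong (_∘ id) i) i ((h' ∘' g') ∘' f'))
        (trans (substirr (trans (cong (_∘ id) i) i)
                         (trans (assoc id id id) (trans (cong (id ∘_) i) i)) _)
        (trans (sym (substsubst (assoc id id id) (trans (cong (id ∘_) i) i) _))
        (trans (cong (subst HW (trans (cong (id ∘_) i) i)) (assoc' h' g' f'))
        (trans (sym (substsubst (cong (id ∘_) i) i (h' ∘' (g' ∘' f'))))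
               (cong (subst HW i) (substʳ i h' (g' ∘' f'))))))))
        where
          i = idˡ id
          HW = λ k → Hom[ k ] X W

record Fibration {B : Category o ℓ} (E : Displayed B o' ℓ') : Set (o ⊔ ℓ ⊔ o' ⊔ ℓ') where
  open Category B
  open Displayed E
  field
    lift : ∀ {I J} (f : Hom J I) (X : Ob[ I ]) →
           Σ[ Y ∈ Ob[ J ] ] Σ[ φ ∈ Hom[ f ] Y X ] IsCartesian φ

  _^*_ : ∀ {I J} (f : Hom J I) (X : Ob[ I ]) → Ob[ J ]
  f ^* X = proj₁ (lift f X)

  cart : ∀ {I J} (f : Hom J I) (X : Ob[ I ]) → Hom[ f ] (f ^* X) X
  cart f X = proj₁ (proj₂ (lift f X))

  cart-isCart : ∀ {I J} (f : Hom J I) (X : Ob[ I ]) → IsCartesian (cart f X)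
  cart-isCart f X = proj₂ (proj₂ (lift f X))

  reindexV : ∀ {I J} (f : Hom J I) {X X' : Ob[ I ]} →
             Hom[ id ] X X' → Hom[ id ] (f ^* X) (f ^* X')
  reindexV f {X} {X'} g =
    proj₁ (cart-isCart f X' id
      (subst (λ h → Hom[ h ] (f ^* X) X') (trans (idˡ f) (sym (idʳ f)))
             (g ∘' cart f X)))

  cmp : ∀ {I J L} (f : Hom J I) (u : Hom L J) {g : Hom L I} (p : f ∘ u ≡ g)
        (X : Ob[ I ]) → Hom[ u ] (g ^* X) (f ^* X)
  cmp f u {g} p X = proj₁ (cart-isCart f X u
                      (subst (λ h → Hom[ h ] (g ^* X) X) (sym p) (cart g X)))

module _ {B : Category o ℓ} (prods : BinaryProducts B)
         {E : Displayed B o' ℓ'} (fib : Fibration E) where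
  open Category B
  open Displayed E
  open Fibration fib

  private
    module P (I J : Obj) = Product (prods I J)

  _⊗_ : Obj → Obj → Obj
  I ⊗ J = P.A×B I J

  record LocallySmall : Set (o ⊔ ℓ ⊔ o' ⊔ ℓ') where
    field
      hom  : ∀ {I J} (A : Ob[ I ]) (X : Ob[ J ]) → SliceObj B (I ⊗ J)
      Φ    : ∀ {I J} (A : Ob[ I ]) (X : Ob[ J ]) {L} (τ : Hom L (I ⊗ J)) →
             SliceHom B (sliceObj L τ) (hom A X)
             ↔ Hom[ id {L} ] ((P.π₀ I J ∘ τ) ^* A) ((P.π₁ I J ∘ τ) ^* X)
      -- naturality in τ: for u : L' → L, Φ_{τu}(h u) = u^*(Φ_τ h)
      -- (expressed after composing with the cartesian map into X)
      Φ-natτ : ∀ {I J} (A : Ob[ I ]) (X : Ob[ J ]) {L L'}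
               (τ : Hom L (I ⊗ J)) (u : Hom L' L)
               (h : SliceHom B (sliceObj L τ) (hom A X)) →
               (cart (P.π₁ I J ∘ (τ ∘ u)) X
                  ∘' Inverse.to (Φ A X (τ ∘ u))
                       (Category._∘_ (Slice B (I ⊗ J)) h (u , refl)))
               ≡[ trans (idʳ _) (trans (sym (assoc _ _ _))
                    (cong ((P.π₁ I J ∘ τ) ∘_) (sym (idˡ u)))) ]
               (cart (P.π₁ I J ∘ τ) X
                  ∘' (Inverse.to (Φ A X τ) h ∘' cmp (P.π₀ I J ∘ τ) u (assoc _ _ _) A))
      homMap : ∀ {I J} (A : Ob[ I ]) {X X' : Ob[ J ]} →
               Hom[ id ] X X' → SliceHom B (hom A X) (hom A X')
      homMap-id : ∀ {I J} (A : Ob[ I ]) {X : Ob[ J ]} →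
                  homMap A (id' {X = X}) ≡ Category.id (Slice B (I ⊗ J))
      homMap-∘  : ∀ {I J} (A : Ob[ I ]) {X X' X'' : Ob[ J ]}
                  (g : Hom[ id ] X' X'') (f : Hom[ id ] X X') →
                  homMap A (Category._∘_ (Fibre J) g f)
                  ≡ Category._∘_ (Slice B (I ⊗ J)) (homMap A g) (homMap A f)
      Φ-natX : ∀ {I J} (A : Ob[ I ]) {X X' : Ob[ J ]} (g : Hom[ id ] X X')
               {L} (τ : Hom L (I ⊗ J)) (h : SliceHom B (sliceObj L τ) (hom A X)) →
               Inverse.to (Φ A X' τ) (Category._∘_ (Slice B (I ⊗ J)) (homMap A g) h)
               ≡ Category._∘_ (Fibre L) (reindexV (P.π₁ I J ∘ τ) g) (Inverse.to (Φ A X τ) h)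

  homFunctor : LocallySmall → ∀ {I} (A : Ob[ I ]) (J : Obj) →
               Functor (Fibre J) (Slice B (I ⊗ J))
  homFunctor ls A J = record
    { F₀ = λ X → LocallySmall.hom ls A X
    ; F₁ = LocallySmall.homMap ls A
    ; F-id = LocallySmall.homMap-id ls A
    ; F-∘ = LocallySmall.homMap-∘ ls A
    }

  TinyRelTo : LocallySmall → (J : Obj) → ∀ {I} (A : Ob[ I ]) → Set (o ⊔ ℓ ⊔ o' ⊔ ℓ')
  TinyRelTo ls J A = RightAdjoint (homFunctor ls A J)

-- B' is, up to vertical isomorphism, the reindexing of B along σ.  Hence for
-- s = σ × J a map into hom(B', X) over τ : L → I × J, i.e. a vertical map
-- (π₀τ)^* B' → (π₁τ)^* X, is the same as a vertical map (π₀sτ)^* B → (π₁sτ)^* X,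
-- i.e. a map into hom(B, X) over sτ, i.e. a map into s^* hom(B, X) over τ.
-- This is natural in τ and X, so by Yoneda hom(B', -) ≅ s^* ∘ hom(B, -), a
-- composite of functors with right adjoints: hom(B, -) by tinyness, s^* ⊣ Π_s.

{-# OPTIONS --safe #-}
module Submission where

open import Level using (Level; _⊔_)
open import Relation.Binary.PropositionalEquality
open import Data.Product using (Σ; Σ-syntax; _,_; proj₁; proj₂)
open import Function.Bundles using (Inverse)
open import Defs

private
  variable
    o ℓ o' ℓ' o₁ ℓ₁ o₂ ℓ₂ o₃ ℓ₃ : Level

module _ {C : Category o₁ ℓ₁} {D : Category o₂ ℓ₂} where
  private
    module C = Category C
    module D = Category D

  infixr 9 _∘F_
  _∘F_ : {E : Category o₃ ℓ₃} → Functor D E → Functor C D → Functor C E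
  P ∘F F = record
    { F₀   = λ X → P.F₀ (F.F₀ X)
    ; F₁   = λ f → P.F₁ (F.F₁ f)
    ; F-id = trans (cong P.F₁ F.F-id) P.F-id
    ; F-∘  = λ g f → trans (cong P.F₁ (F.F-∘ g f)) (P.F-∘ (F.F₁ g) (F.F₁ f))
    }
    where
      module P = Functor P
      module F = Functor F

  record NaturalIso (F G : Functor C D) : Set (o₁ ⊔ ℓ₁ ⊔ ℓ₂) where
    private
      module F = Functor F
      module G = Functor G
    field
      ⇒         : ∀ X → D.Hom (F.F₀ X) (G.F₀ X)
      ⇐         : ∀ X → D.Hom (G.F₀ X) (F.F₀ X)
      ⇐∘⇒       : ∀ X → ⇐ X D.∘ ⇒ X ≡ D.id
      ⇒∘⇐       : ∀ X → ⇒ X D.∘ ⇐ X ≡ D.id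
      ⇒-natural : ∀ {X X'} (f : C.Hom X X') → G.F₁ f D.∘ ⇒ X ≡ ⇒ X' D.∘ F.F₁ f

  -- Naturality in Y is not a field: it follows once R₁ g is defined as
  -- transpose (g ∘ untranspose id).
  record HomBijection (F : Functor C D) : Set (o₁ ⊔ ℓ₁ ⊔ o₂ ⊔ ℓ₂) where
    private module F = Functor F
    field
      R₀                    : D.Obj → C.Obj
      transpose             : ∀ {X Y} → D.Hom (F.F₀ X) Y → C.Hom X (R₀ Y)
      untranspose           : ∀ {X Y} → C.Hom X (R₀ Y) → D.Hom (F.F₀ X) Y
      transpose∘untranspose : ∀ {X Y} (h : C.Hom X (R₀ Y)) → transpose (untranspose h) ≡ h
      untranspose∘transpose : ∀ {X Y} (f : D.Hom (F.F₀ X) Y) → untranspose (transpose f) ≡ f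
      transpose-natural     : ∀ {X X' Y} (f : D.Hom (F.F₀ X') Y) (g : C.Hom X X') →
                              transpose (f D.∘ F.F₁ g) ≡ transpose f C.∘ g

  module _ {F : Functor C D} where
    private module F = Functor F
    open ≡-Reasoning

    rightAdjoint⇒homBijection : RightAdjoint F → HomBijection F
    rightAdjoint⇒homBijection ra = record
      { R₀                    = R.F₀
      ; transpose             = transpose
      ; untranspose           = untranspose
      ; transpose∘untranspose = transpose∘untranspose
      ; untranspose∘transpose = untranspose∘transpose
      ; transpose-natural     = transpose-natural
      }
      where
        open RightAdjoint ra
        module R = Functor G

        transpose : ∀ {X Y} → D.Hom (F.F₀ X) Y → C.Hom X (R.F₀ Y)
        transpose {X} f = R.F₁ f C.∘ η X

        untranspose : ∀ {X Y} → C.Hom X (R.F₀ Y) → D.Hom (F.F₀ X) Y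
        untranspose {Y = Y} h = ε Y D.∘ F.F₁ h

        transpose-natural : ∀ {X X' Y} (f : D.Hom (F.F₀ X') Y) (g : C.Hom X X') →
                            transpose (f D.∘ F.F₁ g) ≡ transpose f C.∘ g
        transpose-natural {X} {X'} f g = begin
          R.F₁ (f D.∘ F.F₁ g) C.∘ η X         ≡⟨ cong (C._∘ η X) (R.F-∘ f (F.F₁ g)) ⟩
          (R.F₁ f C.∘ R.F₁ (F.F₁ g)) C.∘ η X  ≡⟨ C.assoc _ _ _ ⟩
          R.F₁ f C.∘ (R.F₁ (F.F₁ g) C.∘ η X)  ≡⟨ cong (R.F₁ f C.∘_) (η-nat g) ⟩
          R.F₁ f C.∘ (η X' C.∘ g)             ≡⟨ sym (C.assoc _ _ _) ⟩
          (R.F₁ f C.∘ η X') C.∘ g             ∎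

        transpose∘untranspose : ∀ {X Y} (h : C.Hom X (R.F₀ Y)) → transpose (untranspose h) ≡ h
        transpose∘untranspose {Y = Y} h = begin
          R.F₁ (ε Y D.∘ F.F₁ h) C.∘ _  ≡⟨ transpose-natural (ε Y) h ⟩
          (R.F₁ (ε Y) C.∘ η _) C.∘ h   ≡⟨ cong (C._∘ h) (zag Y) ⟩
          C.id C.∘ h                   ≡⟨ C.idˡ h ⟩
          h                            ∎

        untranspose∘transpose : ∀ {X Y} (f : D.Hom (F.F₀ X) Y) → untranspose (transpose f) ≡ f
        untranspose∘transpose {X} {Y} f = begin
          ε Y D.∘ F.F₁ (R.F₁ f C.∘ η X)            ≡⟨ cong (ε Y D.∘_) (F.F-∘ _ _) ⟩
          ε Y D.∘ (F.F₁ (R.F₁ f) D.∘ F.F₁ (η X))   ≡⟨ sym (D.assoc _ _ _) ⟩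
          (ε Y D.∘ F.F₁ (R.F₁ f)) D.∘ F.F₁ (η X)   ≡⟨ cong (D._∘ F.F₁ (η X)) (sym (ε-nat f)) ⟩
          (f D.∘ ε (F.F₀ X)) D.∘ F.F₁ (η X)        ≡⟨ D.assoc _ _ _ ⟩
          f D.∘ (ε (F.F₀ X) D.∘ F.F₁ (η X))        ≡⟨ cong (f D.∘_) (zig X) ⟩
          f D.∘ D.id                               ≡⟨ D.idʳ f ⟩
          f                                        ∎

    homBijection⇒rightAdjoint : HomBijection F → RightAdjoint F
    homBijection⇒rightAdjoint hb = record
      { G = R ; η = η ; ε = ε ; η-nat = η-nat ; ε-nat = ε-nat ; zig = zig ; zag = zag }
      where
        open HomBijection hb

        ε : ∀ Y → D.Hom (F.F₀ (R₀ Y)) Y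
        ε Y = untranspose C.id

        η : ∀ X → C.Hom X (R₀ (F.F₀ X))
        η X = transpose D.id

        R₁ : ∀ {Y Y'} → D.Hom Y Y' → C.Hom (R₀ Y) (R₀ Y')
        R₁ {Y} g = transpose (g D.∘ ε Y)

        transpose-ε∘F₁ : ∀ {X Y} (h : C.Hom X (R₀ Y)) → transpose (ε Y D.∘ F.F₁ h) ≡ h
        transpose-ε∘F₁ {Y = Y} h = begin
          transpose (ε Y D.∘ F.F₁ h)  ≡⟨ transpose-natural (ε Y) h ⟩
          transpose (ε Y) C.∘ h       ≡⟨ cong (C._∘ h) (transpose∘untranspose C.id) ⟩
          C.id C.∘ h                  ≡⟨ C.idˡ h ⟩
          h                           ∎

        untranspose-via-ε : ∀ {X Y} (h : C.Hom X (R₀ Y)) → untranspose h ≡ ε Y D.∘ F.F₁ h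
        untranspose-via-ε h =
          trans (cong untranspose (sym (transpose-ε∘F₁ h))) (untranspose∘transpose _)

        R₁-∘ : ∀ {X Y Y'} (g : D.Hom Y Y') (h : C.Hom X (R₀ Y)) →
               R₁ g C.∘ h ≡ transpose (g D.∘ untranspose h)
        R₁-∘ {Y = Y} g h = begin
          transpose (g D.∘ ε Y) C.∘ h            ≡⟨ sym (transpose-natural _ h) ⟩
          transpose ((g D.∘ ε Y) D.∘ F.F₁ h)     ≡⟨ cong transpose (D.assoc _ _ _) ⟩
          transpose (g D.∘ (ε Y D.∘ F.F₁ h))     ≡⟨ cong (λ k → transpose (g D.∘ k)) (sym (untranspose-via-ε h)) ⟩
          transpose (g D.∘ untranspose h)        ∎

        R : Functor D C
        R = record
          { F₀   = R₀
          ; F₁   = R₁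
          ; F-id = trans (cong transpose (D.idˡ _)) (transpose∘untranspose C.id)
          ; F-∘  = λ {Y} g f → sym (begin
              R₁ g C.∘ R₁ f                                    ≡⟨ R₁-∘ g (R₁ f) ⟩
              transpose (g D.∘ untranspose (transpose (f D.∘ ε Y)))
                ≡⟨ cong (λ k → transpose (g D.∘ k)) (untranspose∘transpose _) ⟩
              transpose (g D.∘ (f D.∘ ε Y))                    ≡⟨ cong transpose (sym (D.assoc _ _ _)) ⟩
              R₁ (g D.∘ f)                                     ∎)
          }

        η-nat : ∀ {X X'} (f : C.Hom X X') → R₁ (F.F₁ f) C.∘ η X ≡ η X' C.∘ f
        η-nat {X} {X'} f = begin
          R₁ (F.F₁ f) C.∘ η X                             ≡⟨ R₁-∘ _ _ ⟩
          transpose (F.F₁ f D.∘ untranspose (transpose D.id))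
            ≡⟨ cong (λ k → transpose (F.F₁ f D.∘ k)) (untranspose∘transpose _) ⟩
          transpose (F.F₁ f D.∘ D.id)                     ≡⟨ cong transpose (trans (D.idʳ _) (sym (D.idˡ _))) ⟩
          transpose (D.id D.∘ F.F₁ f)                     ≡⟨ transpose-natural _ f ⟩
          η X' C.∘ f                                      ∎

        ε-nat : ∀ {Y Y'} (g : D.Hom Y Y') → g D.∘ ε Y ≡ ε Y' D.∘ F.F₁ (R₁ g)
        ε-nat g = sym (trans (sym (untranspose-via-ε (R₁ g))) (untranspose∘transpose _))

        zig : ∀ X → ε (F.F₀ X) D.∘ F.F₁ (η X) ≡ D.id
        zig X = trans (sym (untranspose-via-ε (η X))) (untranspose∘transpose _)

        zag : ∀ Y → R₁ (ε Y) C.∘ η (R₀ Y) ≡ C.id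
        zag Y = begin
          R₁ (ε Y) C.∘ η (R₀ Y)                            ≡⟨ R₁-∘ _ _ ⟩
          transpose (ε Y D.∘ untranspose (transpose D.id))
            ≡⟨ cong (λ k → transpose (ε Y D.∘ k)) (untranspose∘transpose _) ⟩
          transpose (ε Y D.∘ D.id)                         ≡⟨ cong transpose (D.idʳ _) ⟩
          transpose (untranspose C.id)                     ≡⟨ transpose∘untranspose _ ⟩
          C.id                                             ∎

module _ {C : Category o₁ ℓ₁} {D : Category o₂ ℓ₂} {E : Category o₃ ℓ₃} where
  private
    module C = Category C
    module E = Category E
  open ≡-Reasoning

  homBijection-∘ : {F : Functor C D} {P : Functor D E} →
                   HomBijection F → HomBijection P → HomBijection (P ∘F F)
  homBijection-∘ {F} {P} hbF hbP = record
    { R₀                    = λ Y → F.R₀ (P.R₀ Y)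
    ; transpose             = λ f → F.transpose (P.transpose f)
    ; untranspose           = λ h → P.untranspose (F.untranspose h)
    ; transpose∘untranspose = λ h →
        trans (cong F.transpose (P.transpose∘untranspose _)) (F.transpose∘untranspose h)
    ; untranspose∘transpose = λ f →
        trans (cong P.untranspose (F.untranspose∘transpose _)) (P.untranspose∘transpose f)
    ; transpose-natural     = λ f g →
        trans (cong F.transpose (P.transpose-natural f (Functor.F₁ F g)))
              (F.transpose-natural (P.transpose f) g)
    }
    where
      module F = HomBijection hbF
      module P = HomBijection hbP

module _ {C : Category o₁ ℓ₁} {D : Category o₂ ℓ₂} {F G : Functor C D} where
  private
    module C = Category C
    module D = Category D
    module G = Functor G
  open ≡-Reasoning

  homBijection-transfer : HomBijection F → NaturalIso F G → HomBijection G
  homBijection-transfer hb α = record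
    { R₀                    = R₀
    ; transpose             = λ {X} f → transpose (f D.∘ ⇒ X)
    ; untranspose           = λ {X} h → untranspose h D.∘ ⇐ X
    ; transpose∘untranspose = λ {X} h → begin
        transpose ((untranspose h D.∘ ⇐ X) D.∘ ⇒ X)  ≡⟨ cong transpose (D.assoc _ _ _) ⟩
        transpose (untranspose h D.∘ (⇐ X D.∘ ⇒ X))  ≡⟨ cong (λ k → transpose (untranspose h D.∘ k)) (⇐∘⇒ X) ⟩
        transpose (untranspose h D.∘ D.id)           ≡⟨ cong transpose (D.idʳ _) ⟩
        transpose (untranspose h)                    ≡⟨ transpose∘untranspose h ⟩
        h                                            ∎
    ; untranspose∘transpose = λ {X} f → begin
        untranspose (transpose (f D.∘ ⇒ X)) D.∘ ⇐ X  ≡⟨ cong (D._∘ ⇐ X) (untranspose∘transpose _) ⟩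
        (f D.∘ ⇒ X) D.∘ ⇐ X                          ≡⟨ D.assoc _ _ _ ⟩
        f D.∘ (⇒ X D.∘ ⇐ X)                          ≡⟨ cong (f D.∘_) (⇒∘⇐ X) ⟩
        f D.∘ D.id                                   ≡⟨ D.idʳ f ⟩
        f                                            ∎
    ; transpose-natural     = λ {X} {X'} f g → begin
        transpose ((f D.∘ G.F₁ g) D.∘ ⇒ X)           ≡⟨ cong transpose (D.assoc _ _ _) ⟩
        transpose (f D.∘ (G.F₁ g D.∘ ⇒ X))           ≡⟨ cong (λ k → transpose (f D.∘ k)) (⇒-natural g) ⟩
        transpose (f D.∘ (⇒ X' D.∘ Functor.F₁ F g))  ≡⟨ cong transpose (sym (D.assoc _ _ _)) ⟩
        transpose ((f D.∘ ⇒ X') D.∘ Functor.F₁ F g)  ≡⟨ transpose-natural _ g ⟩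
        transpose (f D.∘ ⇒ X') C.∘ g                 ∎
    }
    where
      open HomBijection hb
      open NaturalIso α

module _ {C : Category o₁ ℓ₁} {D : Category o₂ ℓ₂} where
  private
    module C = Category C
    module D = Category D

  record HomNaturalIso (F G : Functor D C) : Set (o₁ ⊔ ℓ₁ ⊔ o₂ ⊔ ℓ₂) where
    private
      module F = Functor F
      module G = Functor G
    field
      θ           : ∀ X {Z} → C.Hom Z (F.F₀ X) → C.Hom Z (G.F₀ X)
      θ⁻¹         : ∀ X {Z} → C.Hom Z (G.F₀ X) → C.Hom Z (F.F₀ X)
      θ⁻¹∘θ       : ∀ X {Z} (h : C.Hom Z (F.F₀ X)) → θ⁻¹ X (θ X h) ≡ h
      θ∘θ⁻¹       : ∀ X {Z} (k : C.Hom Z (G.F₀ X)) → θ X (θ⁻¹ X k) ≡ k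
      θ-natural   : ∀ X {Z Z'} (h : C.Hom Z (F.F₀ X)) (u : C.Hom Z' Z) →
                    θ X (h C.∘ u) ≡ θ X h C.∘ u
      θ-natural-F : ∀ {X X'} (g : D.Hom X X') {Z} (h : C.Hom Z (F.F₀ X)) →
                    θ X' (F.F₁ g C.∘ h) ≡ G.F₁ g C.∘ θ X h

  module _ {F G : Functor D C} where
    private
      module F = Functor F
      module G = Functor G
    open ≡-Reasoning

    homNaturalIso⇒naturalIso : HomNaturalIso F G → NaturalIso F G
    homNaturalIso⇒naturalIso iso = record
      { ⇒         = λ X → θ X C.id
      ; ⇐         = λ X → θ⁻¹ X C.id
      ; ⇐∘⇒       = λ X → begin
          θ⁻¹ X C.id C.∘ θ X C.id       ≡⟨ sym (θ⁻¹-natural X C.id _) ⟩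
          θ⁻¹ X (C.id C.∘ θ X C.id)     ≡⟨ cong (θ⁻¹ X) (C.idˡ _) ⟩
          θ⁻¹ X (θ X C.id)              ≡⟨ θ⁻¹∘θ X C.id ⟩
          C.id                          ∎
      ; ⇒∘⇐       = λ X → begin
          θ X C.id C.∘ θ⁻¹ X C.id       ≡⟨ sym (θ-natural X C.id _) ⟩
          θ X (C.id C.∘ θ⁻¹ X C.id)     ≡⟨ cong (θ X) (C.idˡ _) ⟩
          θ X (θ⁻¹ X C.id)              ≡⟨ θ∘θ⁻¹ X C.id ⟩
          C.id                          ∎
      ; ⇒-natural = λ {X} {X'} g → begin
          G.F₁ g C.∘ θ X C.id           ≡⟨ sym (θ-natural-F g C.id) ⟩
          θ X' (F.F₁ g C.∘ C.id)        ≡⟨ cong (θ X') (trans (C.idʳ _) (sym (C.idˡ _))) ⟩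
          θ X' (C.id C.∘ F.F₁ g)        ≡⟨ θ-natural X' C.id (F.F₁ g) ⟩
          θ X' C.id C.∘ F.F₁ g          ∎
      }
      where
        open HomNaturalIso iso

        θ⁻¹-natural : ∀ X {Z Z'} (k : C.Hom Z (G.F₀ X)) (u : C.Hom Z' Z) →
                      θ⁻¹ X (k C.∘ u) ≡ θ⁻¹ X k C.∘ u
        θ⁻¹-natural X k u = begin
          θ⁻¹ X (k C.∘ u)                   ≡⟨ cong (λ k' → θ⁻¹ X (k' C.∘ u)) (sym (θ∘θ⁻¹ X k)) ⟩
          θ⁻¹ X (θ X (θ⁻¹ X k) C.∘ u)       ≡⟨ cong (θ⁻¹ X) (sym (θ-natural X _ u)) ⟩
          θ⁻¹ X (θ X (θ⁻¹ X k C.∘ u))       ≡⟨ θ⁻¹∘θ X _ ⟩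
          θ⁻¹ X k C.∘ u                     ∎

module Slices (C : Category o ℓ) where
  infixr 9 _∘ₛ_
  _∘ₛ_ : ∀ {V} {A₁ A₂ A₃ : SliceObj C V} → SliceHom C A₂ A₃ → SliceHom C A₁ A₂ → SliceHom C A₁ A₃
  _∘ₛ_ {V} = Category._∘_ (Slice C V)

  SliceHom-≡ : ∀ {V} {A A' : SliceObj C V} {f g : SliceHom C A A'} → proj₁ f ≡ proj₁ g → f ≡ g
  SliceHom-≡ {f = h , p} {g = .h , q} refl = cong (h ,_) (uip′ p q)

module SlicePullback {C : Category o ℓ} (pb : Pullbacks C) {X Y : Category.Obj C} (f : Category.Hom C X Y) where
  open Category C
  open Slices C
  private
    module f^* = Functor (pullbackFunctor C pb f)
    module PB (Z : SliceObj C Y) = Pullback (pb (arr Z) f)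
  open ≡-Reasoning

  Σ-map : ∀ {L L'} {τ : Hom L X} {τ' : Hom L' X} → SliceHom C (sliceObj L' τ') (sliceObj L τ) →
          SliceHom C (sliceObj L' (f ∘ τ')) (sliceObj L (f ∘ τ))
  Σ-map (u , e) = u , trans (assoc _ _ u) (cong (f ∘_) e)

  module _ {L : Obj} {τ : Hom L X} (Z : SliceObj C Y) where
    Σ-transpose : SliceHom C (sliceObj L (f ∘ τ)) Z → SliceHom C (sliceObj L τ) (f^*.F₀ Z)
    Σ-transpose (m , em) = PB.universal Z m τ em , PB.βp₂ Z m τ em

    Σ-untranspose : SliceHom C (sliceObj L τ) (f^*.F₀ Z) → SliceHom C (sliceObj L (f ∘ τ)) Z
    Σ-untranspose (k , ek) = PB.p₁ Z ∘ k , (begin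
      arr Z ∘ (PB.p₁ Z ∘ k)  ≡⟨ sym (assoc _ _ _) ⟩
      (arr Z ∘ PB.p₁ Z) ∘ k  ≡⟨ cong (_∘ k) (PB.commute Z) ⟩
      (f ∘ PB.p₂ Z) ∘ k      ≡⟨ assoc _ _ _ ⟩
      f ∘ (PB.p₂ Z ∘ k)      ≡⟨ cong (f ∘_) ek ⟩
      f ∘ τ                  ∎)

    Σ-transpose∘untranspose : ∀ k → Σ-transpose (Σ-untranspose k) ≡ k
    Σ-transpose∘untranspose (k , ek) = SliceHom-≡ (sym (PB.uniq Z _ _ _ k refl ek))

    Σ-untranspose∘transpose : ∀ m → Σ-untranspose (Σ-transpose m) ≡ m
    Σ-untranspose∘transpose (m , em) = SliceHom-≡ (PB.βp₁ Z m τ em)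

  Σ-untranspose-natural : ∀ (Z : SliceObj C Y) {L L'} {τ : Hom L X} {τ' : Hom L' X}
                          (k : SliceHom C (sliceObj L τ) (f^*.F₀ Z))
                          (u : SliceHom C (sliceObj L' τ') (sliceObj L τ)) →
                          Σ-untranspose Z (k ∘ₛ u) ≡ Σ-untranspose Z k ∘ₛ Σ-map u
  Σ-untranspose-natural Z k u = SliceHom-≡ (sym (assoc _ _ _))

  Σ-untranspose-natural-f^* : ∀ {Z Z' : SliceObj C Y} (m : SliceHom C Z Z') {L} {τ : Hom L X}
                              (k : SliceHom C (sliceObj L τ) (f^*.F₀ Z)) →
                              Σ-untranspose Z' (f^*.F₁ m ∘ₛ k) ≡ m ∘ₛ Σ-untranspose Z k
  Σ-untranspose-natural-f^* {Z} {Z'} m k = SliceHom-≡ (begin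
    PB.p₁ Z' ∘ (proj₁ (f^*.F₁ m) ∘ proj₁ k)  ≡⟨ sym (assoc _ _ _) ⟩
    (PB.p₁ Z' ∘ proj₁ (f^*.F₁ m)) ∘ proj₁ k  ≡⟨ cong (_∘ proj₁ k) (PB.βp₁ Z' _ _ _) ⟩
    (proj₁ m ∘ PB.p₁ Z) ∘ proj₁ k            ≡⟨ assoc _ _ _ ⟩
    proj₁ m ∘ (PB.p₁ Z ∘ proj₁ k)            ∎)

-- Working with maps of the total category avoids transporting displayed maps
-- along equalities of base maps.
module TotalMaps {𝔹 : Category o ℓ} (𝔼 : Displayed 𝔹 o' ℓ') where
  open Category 𝔹
  open Displayed 𝔼

  Total : ∀ {I J} → Ob[ I ] → Ob[ J ] → Set (ℓ ⊔ ℓ')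
  Total {I} {J} X Y = Σ (Hom I J) (λ f → Hom[ f ] X Y)

  infixr 9 _∘ₜ_
  _∘ₜ_ : ∀ {I J K} {X : Ob[ I ]} {Y : Ob[ J ]} {Z : Ob[ K ]} → Total Y Z → Total X Y → Total X Z
  (f , a) ∘ₜ (g , b) = f ∘ g , a ∘' b

  ⟪_⟫ : ∀ {I J} {f : Hom I J} {X Y} → Hom[ f ] X Y → Total X Y
  ⟪_⟫ {f = f} a = f , a

  ⟪⟫-≡ : ∀ {I J} {f g : Hom I J} {X Y} {a : Hom[ f ] X Y} {b : Hom[ g ] X Y}
         (p : f ≡ g) → a ≡[ p ] b → ⟪ a ⟫ ≡ ⟪ b ⟫
  ⟪⟫-≡ refl refl = refl

  ⟪⟫-injective : ∀ {I J} {f : Hom I J} {X Y} {a b : Hom[ f ] X Y} → ⟪ a ⟫ ≡ ⟪ b ⟫ → a ≡ b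
  ⟪⟫-injective refl = refl

  assocₜ : ∀ {I₁ I₂ I₃ I₄} {W : Ob[ I₁ ]} {X : Ob[ I₂ ]} {Y : Ob[ I₃ ]} {Z : Ob[ I₄ ]}
           (a : Total Y Z) (b : Total X Y) (c : Total W X) → (a ∘ₜ b) ∘ₜ c ≡ a ∘ₜ (b ∘ₜ c)
  assocₜ (h , a) (g , b) (f , c) = ⟪⟫-≡ (assoc h g f) (assoc' a b c)

  idʳₜ : ∀ {I J} {X : Ob[ I ]} {Y : Ob[ J ]} (a : Total X Y) → a ∘ₜ ⟪ id' ⟫ ≡ a
  idʳₜ (f , a) = ⟪⟫-≡ (idʳ f) (idʳ' a)

  ⟪⟫-vertical-∘ : ∀ {L} {X Y Z : Ob[ L ]} (g : Hom[ id ] Y Z) (f : Hom[ id ] X Y) →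
                  ⟪ Category._∘_ (Fibre L) g f ⟫ ≡ ⟪ g ⟫ ∘ₜ ⟪ f ⟫
  ⟪⟫-vertical-∘ g f = sym (⟪⟫-≡ (idˡ id) refl)

  module _ {I J} {f : Hom J I} {Y : Ob[ J ]} {X : Ob[ I ]} {φ : Hom[ f ] Y X} (cartesian : IsCartesian φ) where
    cartesian-cancelˡ : ∀ {L} {Z : Ob[ L ]} (a b : Total Z Y) → proj₁ a ≡ proj₁ b →
                        ⟪ φ ⟫ ∘ₜ a ≡ ⟪ φ ⟫ ∘ₜ b → a ≡ b
    cartesian-cancelˡ (g , a) (.g , b) refl e = cong ⟪_⟫ (trans (unique a (⟪⟫-injective e)) (sym (unique b refl)))
      where unique = proj₂ (proj₂ (cartesian g (φ ∘' b)))

    cartesian-factor : ∀ {L} {Z : Ob[ L ]} (g : Hom L J) (ψ : Total Z X) → proj₁ ψ ≡ f ∘ g →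
                       Σ[ χ ∈ Hom[ g ] Z Y ] (⟪ φ ⟫ ∘ₜ ⟪ χ ⟫ ≡ ψ)
    cartesian-factor {Z = Z} g (h , ψ) p =
      proj₁ r , trans (cong ⟪_⟫ (proj₁ (proj₂ r))) (sym (⟪⟫-≡ p refl))
      where r = cartesian g (subst (λ k → Hom[ k ] Z _) p ψ)

module CleavageLemmas {𝔹 : Category o ℓ} {𝔼 : Displayed 𝔹 o' ℓ'} (fib : Fibration 𝔼) where
  open Category 𝔹
  open Displayed 𝔼
  open Fibration fib
  open TotalMaps 𝔼

  cart-∘-cmp : ∀ {I J L} (f : Hom J I) (u : Hom L J) {g : Hom L I} (p : f ∘ u ≡ g) (X : Ob[ I ]) →
               ⟪ cart f X ⟫ ∘ₜ ⟪ cmp f u p X ⟫ ≡ ⟪ cart g X ⟫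
  cart-∘-cmp f u {g} p X =
    trans (cong ⟪_⟫ (proj₁ (proj₂ (cart-isCart f X u (subst (λ h → Hom[ h ] (g ^* X) X) (sym p) (cart g X))))))
          (sym (⟪⟫-≡ (sym p) refl))

  cart-∘-reindexV : ∀ {I J} (f : Hom J I) {X X' : Ob[ I ]} (g : Hom[ id ] X X') →
                    ⟪ cart f X' ⟫ ∘ₜ ⟪ reindexV f g ⟫ ≡ ⟪ g ⟫ ∘ₜ ⟪ cart f X ⟫
  cart-∘-reindexV f {X} {X'} g =
    trans (cong ⟪_⟫ (proj₁ (proj₂ (cart-isCart f X' id
            (subst (λ h → Hom[ h ] (f ^* X) X') (trans (idˡ f) (sym (idʳ f))) (g ∘' cart f X))))))
          (sym (⟪⟫-≡ (trans (idˡ f) (sym (idʳ f))) refl))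

module CartesianComparison {𝔹 : Category o ℓ} {𝔼 : Displayed 𝔹 o' ℓ'} (fib : Fibration 𝔼)
  {I K : Category.Obj 𝔹} {σ : Category.Hom 𝔹 I K} {B' : Displayed.Ob[_] 𝔼 I} {B : Displayed.Ob[_] 𝔼 K}
  {c : Displayed.Hom[_] 𝔼 σ B' B} (c-cartesian : Displayed.IsCartesian 𝔼 c) where
  open Category 𝔹
  open Displayed 𝔼
  open Fibration fib
  open TotalMaps 𝔼
  open CleavageLemmas fib
  open ≡-Reasoning

  module _ {L : Obj} (f : Hom L I) (g : Hom L K) (p : g ≡ σ ∘ f) where
    private
      comparisonΣ = cartesian-factor (cart-isCart g B) id (⟪ c ⟫ ∘ₜ ⟪ cart f B' ⟫) (trans (sym p) (sym (idʳ g)))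
      cart-over-c = cartesian-factor c-cartesian f ⟪ cart g B ⟫ p
      comparison⁻¹Σ = cartesian-factor (cart-isCart f B') id ⟪ proj₁ cart-over-c ⟫ (sym (idʳ f))

    comparison : Hom[ id ] (f ^* B') (g ^* B)
    comparison = proj₁ comparisonΣ

    cart-∘-comparison : ⟪ cart g B ⟫ ∘ₜ ⟪ comparison ⟫ ≡ ⟪ c ⟫ ∘ₜ ⟪ cart f B' ⟫
    cart-∘-comparison = proj₂ comparisonΣ

    comparison⁻¹ : Hom[ id ] (g ^* B) (f ^* B')
    comparison⁻¹ = proj₁ comparison⁻¹Σ

    c∘cart-∘-comparison⁻¹ : ⟪ c ⟫ ∘ₜ (⟪ cart f B' ⟫ ∘ₜ ⟪ comparison⁻¹ ⟫) ≡ ⟪ cart g B ⟫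
    c∘cart-∘-comparison⁻¹ = trans (cong (⟪ c ⟫ ∘ₜ_) (proj₂ comparison⁻¹Σ)) (proj₂ cart-over-c)

    comparison∘comparison⁻¹ : ⟪ comparison ⟫ ∘ₜ ⟪ comparison⁻¹ ⟫ ≡ ⟪ id' ⟫
    comparison∘comparison⁻¹ = cartesian-cancelˡ (cart-isCart g B) _ _ (idˡ id) (begin
      ⟪ cart g B ⟫ ∘ₜ (⟪ comparison ⟫ ∘ₜ ⟪ comparison⁻¹ ⟫)
        ≡⟨ sym (assocₜ _ _ _) ⟩
      (⟪ cart g B ⟫ ∘ₜ ⟪ comparison ⟫) ∘ₜ ⟪ comparison⁻¹ ⟫
        ≡⟨ cong (_∘ₜ ⟪ comparison⁻¹ ⟫) cart-∘-comparison ⟩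
      (⟪ c ⟫ ∘ₜ ⟪ cart f B' ⟫) ∘ₜ ⟪ comparison⁻¹ ⟫
        ≡⟨ assocₜ _ _ _ ⟩
      ⟪ c ⟫ ∘ₜ (⟪ cart f B' ⟫ ∘ₜ ⟪ comparison⁻¹ ⟫)
        ≡⟨ c∘cart-∘-comparison⁻¹ ⟩
      ⟪ cart g B ⟫
        ≡⟨ sym (idʳₜ _) ⟩
      ⟪ cart g B ⟫ ∘ₜ ⟪ id' ⟫ ∎)

    comparison⁻¹∘comparison : ⟪ comparison⁻¹ ⟫ ∘ₜ ⟪ comparison ⟫ ≡ ⟪ id' ⟫
    comparison⁻¹∘comparison =
      cartesian-cancelˡ (cart-isCart f B') _ _ (idˡ id)
        (cartesian-cancelˡ c-cartesian _ _ (cong (f ∘_) (idˡ id)) (begin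
          ⟪ c ⟫ ∘ₜ (⟪ cart f B' ⟫ ∘ₜ (⟪ comparison⁻¹ ⟫ ∘ₜ ⟪ comparison ⟫))
            ≡⟨ cong (⟪ c ⟫ ∘ₜ_) (sym (assocₜ _ _ _)) ⟩
          ⟪ c ⟫ ∘ₜ ((⟪ cart f B' ⟫ ∘ₜ ⟪ comparison⁻¹ ⟫) ∘ₜ ⟪ comparison ⟫)
            ≡⟨ sym (assocₜ _ _ _) ⟩
          (⟪ c ⟫ ∘ₜ (⟪ cart f B' ⟫ ∘ₜ ⟪ comparison⁻¹ ⟫)) ∘ₜ ⟪ comparison ⟫
            ≡⟨ cong (_∘ₜ ⟪ comparison ⟫) c∘cart-∘-comparison⁻¹ ⟩
          ⟪ cart g B ⟫ ∘ₜ ⟪ comparison ⟫  ≡⟨ cart-∘-comparison ⟩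
          ⟪ c ⟫ ∘ₜ ⟪ cart f B' ⟫          ≡⟨ cong (⟪ c ⟫ ∘ₜ_) (sym (idʳₜ _)) ⟩
          ⟪ c ⟫ ∘ₜ (⟪ cart f B' ⟫ ∘ₜ ⟪ id' ⟫) ∎))

  comparison-natural : ∀ {L L'} {f : Hom L I} {g : Hom L K} (p : g ≡ σ ∘ f)
                       {f' : Hom L' I} {g' : Hom L' K} (p' : g' ≡ σ ∘ f')
                       (u : Hom L' L) (pf : f ∘ u ≡ f') (pg : g ∘ u ≡ g') →
                       ⟪ cmp g u pg B ⟫ ∘ₜ ⟪ comparison f' g' p' ⟫ ≡ ⟪ comparison f g p ⟫ ∘ₜ ⟪ cmp f u pf B' ⟫
  comparison-natural {f = f} {g} p {f'} {g'} p' u pf pg =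
    cartesian-cancelˡ (cart-isCart g B) _ _ (trans (idʳ u) (sym (idˡ u))) (begin
      ⟪ cart g B ⟫ ∘ₜ (⟪ cmpK ⟫ ∘ₜ ⟪ comparison f' g' p' ⟫)
        ≡⟨ sym (assocₜ _ _ _) ⟩
      (⟪ cart g B ⟫ ∘ₜ ⟪ cmpK ⟫) ∘ₜ ⟪ comparison f' g' p' ⟫
        ≡⟨ cong (_∘ₜ ⟪ comparison f' g' p' ⟫) (cart-∘-cmp g u pg B) ⟩
      ⟪ cart g' B ⟫ ∘ₜ ⟪ comparison f' g' p' ⟫
        ≡⟨ cart-∘-comparison f' g' p' ⟩
      ⟪ c ⟫ ∘ₜ ⟪ cart f' B' ⟫
        ≡⟨ cong (⟪ c ⟫ ∘ₜ_) (sym (cart-∘-cmp f u pf B')) ⟩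
      ⟪ c ⟫ ∘ₜ (⟪ cart f B' ⟫ ∘ₜ ⟪ cmpI ⟫)
        ≡⟨ sym (assocₜ _ _ _) ⟩
      (⟪ c ⟫ ∘ₜ ⟪ cart f B' ⟫) ∘ₜ ⟪ cmpI ⟫
        ≡⟨ cong (_∘ₜ ⟪ cmpI ⟫) (sym (cart-∘-comparison f g p)) ⟩
      (⟪ cart g B ⟫ ∘ₜ ⟪ comparison f g p ⟫) ∘ₜ ⟪ cmpI ⟫
        ≡⟨ assocₜ _ _ _ ⟩
      ⟪ cart g B ⟫ ∘ₜ (⟪ comparison f g p ⟫ ∘ₜ ⟪ cmpI ⟫) ∎)
    where
      cmpI = cmp f u pf B'
      cmpK = cmp g u pg B

module TotalTranspose {𝔹 : Category o ℓ} (prods : BinaryProducts 𝔹) {𝔼 : Displayed 𝔹 o' ℓ'}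
  (fib : Fibration 𝔼) (ls : LocallySmall prods fib) where
  open Category 𝔹
  open Displayed 𝔼
  open Fibration fib
  open LocallySmall ls
  open TotalMaps 𝔼
  open CleavageLemmas fib
  open Slices 𝔹
  open ≡-Reasoning

  module _ {I J : Obj} (A : Ob[ I ]) where
    private module P = Product (prods I J)

    transposeₜ : ∀ (X : Ob[ J ]) {L} (τ : Hom L P.A×B) →
                 SliceHom 𝔹 (sliceObj L τ) (hom A X) → Total ((P.π₀ ∘ τ) ^* A) X
    transposeₜ X τ h = ⟪ cart (P.π₁ ∘ τ) X ⟫ ∘ₜ ⟪ Inverse.to (Φ A X τ) h ⟫

    transposeₜ-injective : ∀ {X L} {τ : Hom L P.A×B} {h h' : SliceHom 𝔹 (sliceObj L τ) (hom A X)} →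
                           transposeₜ X τ h ≡ transposeₜ X τ h' → h ≡ h'
    transposeₜ-injective {X} {τ = τ} {h} {h'} e = begin
      h            ≡⟨ sym (strictlyInverseʳ h) ⟩
      from (to h)  ≡⟨ cong from (⟪⟫-injective (cartesian-cancelˡ (cart-isCart _ X) _ _ refl e)) ⟩
      from (to h') ≡⟨ strictlyInverseʳ h' ⟩
      h'           ∎
      where open Inverse (Φ A X τ)

    module _ (X : Ob[ J ]) {L} (τ : Hom L P.A×B)
             (w : Total ((P.π₀ ∘ τ) ^* A) X) (p : proj₁ w ≡ P.π₁ ∘ τ) where
      private
        factorisation = cartesian-factor (cart-isCart (P.π₁ ∘ τ) X) id w (trans p (sym (idʳ _)))

      untransposeₜ : SliceHom 𝔹 (sliceObj L τ) (hom A X)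
      untransposeₜ = Inverse.from (Φ A X τ) (proj₁ factorisation)

      transposeₜ-untransposeₜ : transposeₜ X τ untransposeₜ ≡ w
      transposeₜ-untransposeₜ =
        trans (cong (λ v → ⟪ cart (P.π₁ ∘ τ) X ⟫ ∘ₜ ⟪ v ⟫) (Inverse.strictlyInverseˡ (Φ A X τ) _))
              (proj₂ factorisation)

    transposeₜ-natural : ∀ (X : Ob[ J ]) {L L'} (τ : Hom L P.A×B) {τ' : Hom L' P.A×B}
                         (u : SliceHom 𝔹 (sliceObj L' τ') (sliceObj L τ))
                         (h : SliceHom 𝔹 (sliceObj L τ) (hom A X))
                         (p : (P.π₀ ∘ τ) ∘ proj₁ u ≡ P.π₀ ∘ τ') →
                         transposeₜ X τ' (h ∘ₛ u) ≡ transposeₜ X τ h ∘ₜ ⟪ cmp (P.π₀ ∘ τ) (proj₁ u) p A ⟫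
    transposeₜ-natural X τ (u , refl) h p = begin
      transposeₜ X (τ ∘ u) (h ∘ₛ (u , refl))
        ≡⟨ ⟪⟫-≡ _ (Φ-natτ A X τ u h) ⟩
      ⟪ cart (P.π₁ ∘ τ) X ⟫ ∘ₜ (⟪ to h ⟫ ∘ₜ ⟪ cmp (P.π₀ ∘ τ) u (assoc _ _ _) A ⟫)
        ≡⟨ cong (λ q → ⟪ cart (P.π₁ ∘ τ) X ⟫ ∘ₜ (⟪ to h ⟫ ∘ₜ ⟪ cmp (P.π₀ ∘ τ) u q A ⟫))
                (uip′ _ p) ⟩
      ⟪ cart (P.π₁ ∘ τ) X ⟫ ∘ₜ (⟪ to h ⟫ ∘ₜ ⟪ cmp (P.π₀ ∘ τ) u p A ⟫)
        ≡⟨ sym (assocₜ _ _ _) ⟩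
      transposeₜ X τ h ∘ₜ ⟪ cmp (P.π₀ ∘ τ) u p A ⟫ ∎
      where to = Inverse.to (Φ A X τ)

    transposeₜ-natural-homMap : ∀ {X X' : Ob[ J ]} (g : Hom[ id ] X X') {L} (τ : Hom L P.A×B)
                                (h : SliceHom 𝔹 (sliceObj L τ) (hom A X)) →
                                transposeₜ X' τ (homMap A g ∘ₛ h) ≡ ⟪ g ⟫ ∘ₜ transposeₜ X τ h
    transposeₜ-natural-homMap {X} {X'} g τ h = begin
      ⟪ cart f X' ⟫ ∘ₜ ⟪ to' (homMap A g ∘ₛ h) ⟫
        ≡⟨ cong (⟪ cart f X' ⟫ ∘ₜ_) (trans (cong ⟪_⟫ (Φ-natX A g τ h)) (⟪⟫-vertical-∘ _ _)) ⟩
      ⟪ cart f X' ⟫ ∘ₜ (⟪ reindexV f g ⟫ ∘ₜ ⟪ to h ⟫)  ≡⟨ sym (assocₜ _ _ _) ⟩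
      (⟪ cart f X' ⟫ ∘ₜ ⟪ reindexV f g ⟫) ∘ₜ ⟪ to h ⟫  ≡⟨ cong (_∘ₜ ⟪ to h ⟫) (cart-∘-reindexV f g) ⟩
      (⟪ g ⟫ ∘ₜ ⟪ cart f X ⟫) ∘ₜ ⟪ to h ⟫              ≡⟨ assocₜ _ _ _ ⟩
      ⟪ g ⟫ ∘ₜ transposeₜ X τ h                       ∎
      where
        f = P.π₁ ∘ τ
        to = Inverse.to (Φ A X τ)
        to' = Inverse.to (Φ A X' τ)

module HomAlongCartesian {𝔹 : Category o ℓ} (lcc : LCCC 𝔹) {𝔼 : Displayed 𝔹 o' ℓ'} {fib : Fibration 𝔼}
  (ls : LocallySmall (LCCC.products lcc) fib) (J : Category.Obj 𝔹)
  {I K : Category.Obj 𝔹} {σ : Category.Hom 𝔹 I K} {B' : Displayed.Ob[_] 𝔼 I} {B : Displayed.Ob[_] 𝔼 K}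
  {c : Displayed.Hom[_] 𝔼 σ B' B} (c-cartesian : Displayed.IsCartesian 𝔼 c) where
  open Category 𝔹
  open Displayed 𝔼
  open Fibration fib
  open LocallySmall ls
  open TotalMaps 𝔼
  open Slices 𝔹
  open CartesianComparison fib c-cartesian
  open ≡-Reasoning
  private
    prods = LCCC.products lcc
    module PI = Product (prods I J)
    module PK = Product (prods K J)
  open TotalTranspose prods fib ls

  σ×J : Hom PI.A×B PK.A×B
  σ×J = PK.⟨ σ ∘ PI.π₀ , PI.π₁ ⟩

  open SlicePullback {C = 𝔹} (LCCC.pullbacks lcc) σ×J

  π₀-σ×J : ∀ {L} (τ : Hom L PI.A×B) → PK.π₀ ∘ (σ×J ∘ τ) ≡ σ ∘ (PI.π₀ ∘ τ)
  π₀-σ×J τ = trans (sym (assoc _ _ _)) (trans (cong (_∘ τ) (PK.β₀ _ _)) (assoc _ _ _))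

  π₁-σ×J : ∀ {L} (τ : Hom L PI.A×B) → PK.π₁ ∘ (σ×J ∘ τ) ≡ PI.π₁ ∘ τ
  π₁-σ×J τ = trans (sym (assoc _ _ _)) (cong (_∘ τ) (PK.β₁ _ _))

  private
    comparisonAt : ∀ {L} (τ : Hom L PI.A×B) → Hom[ id ] ((PI.π₀ ∘ τ) ^* B') ((PK.π₀ ∘ (σ×J ∘ τ)) ^* B)
    comparisonAt τ = comparison (PI.π₀ ∘ τ) (PK.π₀ ∘ (σ×J ∘ τ)) (π₀-σ×J τ)

    comparisonAt⁻¹ : ∀ {L} (τ : Hom L PI.A×B) → Hom[ id ] ((PK.π₀ ∘ (σ×J ∘ τ)) ^* B) ((PI.π₀ ∘ τ) ^* B')
    comparisonAt⁻¹ τ = comparison⁻¹ (PI.π₀ ∘ τ) (PK.π₀ ∘ (σ×J ∘ τ)) (π₀-σ×J τ)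

  module _ (X : Ob[ J ]) {L : Obj} (τ : Hom L PI.A×B) where
    reindexHom : SliceHom 𝔹 (sliceObj L (σ×J ∘ τ)) (hom B X) → SliceHom 𝔹 (sliceObj L τ) (hom B' X)
    reindexHom k = untransposeₜ B' X τ (transposeₜ B X (σ×J ∘ τ) k ∘ₜ ⟪ comparisonAt τ ⟫)
                     (trans (idʳ _) (trans (idʳ _) (π₁-σ×J τ)))

    reindexHom⁻¹ : SliceHom 𝔹 (sliceObj L τ) (hom B' X) → SliceHom 𝔹 (sliceObj L (σ×J ∘ τ)) (hom B X)
    reindexHom⁻¹ h = untransposeₜ B X (σ×J ∘ τ) (transposeₜ B' X τ h ∘ₜ ⟪ comparisonAt⁻¹ τ ⟫)
                       (trans (idʳ _) (trans (idʳ _) (sym (π₁-σ×J τ))))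

    transposeₜ-reindexHom : ∀ k → transposeₜ B' X τ (reindexHom k)
                                  ≡ transposeₜ B X (σ×J ∘ τ) k ∘ₜ ⟪ comparisonAt τ ⟫
    transposeₜ-reindexHom k = transposeₜ-untransposeₜ B' X τ _ _

    transposeₜ-reindexHom⁻¹ : ∀ h → transposeₜ B X (σ×J ∘ τ) (reindexHom⁻¹ h)
                                    ≡ transposeₜ B' X τ h ∘ₜ ⟪ comparisonAt⁻¹ τ ⟫
    transposeₜ-reindexHom⁻¹ h = transposeₜ-untransposeₜ B X (σ×J ∘ τ) _ _

    reindexHom∘reindexHom⁻¹ : ∀ h → reindexHom (reindexHom⁻¹ h) ≡ h
    reindexHom∘reindexHom⁻¹ h = transposeₜ-injective B' (begin
      transposeₜ B' X τ (reindexHom (reindexHom⁻¹ h))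
        ≡⟨ transposeₜ-reindexHom _ ⟩
      transposeₜ B X (σ×J ∘ τ) (reindexHom⁻¹ h) ∘ₜ ⟪ comparisonAt τ ⟫
        ≡⟨ cong (_∘ₜ ⟪ comparisonAt τ ⟫) (transposeₜ-reindexHom⁻¹ h) ⟩
      (transposeₜ B' X τ h ∘ₜ ⟪ comparisonAt⁻¹ τ ⟫) ∘ₜ ⟪ comparisonAt τ ⟫
        ≡⟨ assocₜ _ _ _ ⟩
      transposeₜ B' X τ h ∘ₜ (⟪ comparisonAt⁻¹ τ ⟫ ∘ₜ ⟪ comparisonAt τ ⟫)
        ≡⟨ cong (transposeₜ B' X τ h ∘ₜ_) (comparison⁻¹∘comparison _ _ _) ⟩
      transposeₜ B' X τ h ∘ₜ ⟪ id' ⟫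
        ≡⟨ idʳₜ _ ⟩
      transposeₜ B' X τ h ∎)

    reindexHom⁻¹∘reindexHom : ∀ k → reindexHom⁻¹ (reindexHom k) ≡ k
    reindexHom⁻¹∘reindexHom k = transposeₜ-injective B (begin
      transposeₜ B X (σ×J ∘ τ) (reindexHom⁻¹ (reindexHom k))
        ≡⟨ transposeₜ-reindexHom⁻¹ _ ⟩
      transposeₜ B' X τ (reindexHom k) ∘ₜ ⟪ comparisonAt⁻¹ τ ⟫
        ≡⟨ cong (_∘ₜ ⟪ comparisonAt⁻¹ τ ⟫) (transposeₜ-reindexHom k) ⟩
      (transposeₜ B X (σ×J ∘ τ) k ∘ₜ ⟪ comparisonAt τ ⟫) ∘ₜ ⟪ comparisonAt⁻¹ τ ⟫
        ≡⟨ assocₜ _ _ _ ⟩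
      transposeₜ B X (σ×J ∘ τ) k ∘ₜ (⟪ comparisonAt τ ⟫ ∘ₜ ⟪ comparisonAt⁻¹ τ ⟫)
        ≡⟨ cong (transposeₜ B X (σ×J ∘ τ) k ∘ₜ_) (comparison∘comparison⁻¹ _ _ _) ⟩
      transposeₜ B X (σ×J ∘ τ) k ∘ₜ ⟪ id' ⟫
        ≡⟨ idʳₜ _ ⟩
      transposeₜ B X (σ×J ∘ τ) k ∎)

  reindexHom-natural : ∀ (X : Ob[ J ]) {L L'} (τ : Hom L PI.A×B) {τ' : Hom L' PI.A×B}
                       (u : SliceHom 𝔹 (sliceObj L' τ') (sliceObj L τ))
                       (k : SliceHom 𝔹 (sliceObj L (σ×J ∘ τ)) (hom B X)) →
                       reindexHom X τ' (k ∘ₛ Σ-map u) ≡ reindexHom X τ k ∘ₛ u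
  reindexHom-natural X τ {τ'} u@(v , e) k = transposeₜ-injective B' (begin
    transposeₜ B' X τ' (reindexHom X τ' (k ∘ₛ Σ-map u))
      ≡⟨ transposeₜ-reindexHom X τ' _ ⟩
    transposeₜ B X (σ×J ∘ τ') (k ∘ₛ Σ-map u) ∘ₜ ⟪ comparisonAt τ' ⟫
      ≡⟨ cong (_∘ₜ ⟪ comparisonAt τ' ⟫) (transposeₜ-natural B X (σ×J ∘ τ) (Σ-map u) k pK) ⟩
    (transposeₜ B X (σ×J ∘ τ) k ∘ₜ ⟪ cmpK ⟫) ∘ₜ ⟪ comparisonAt τ' ⟫
      ≡⟨ assocₜ _ _ _ ⟩
    transposeₜ B X (σ×J ∘ τ) k ∘ₜ (⟪ cmpK ⟫ ∘ₜ ⟪ comparisonAt τ' ⟫)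
      ≡⟨ cong (transposeₜ B X (σ×J ∘ τ) k ∘ₜ_) (comparison-natural (π₀-σ×J τ) (π₀-σ×J τ') v pI pK) ⟩
    transposeₜ B X (σ×J ∘ τ) k ∘ₜ (⟪ comparisonAt τ ⟫ ∘ₜ ⟪ cmpI ⟫)
      ≡⟨ sym (assocₜ _ _ _) ⟩
    (transposeₜ B X (σ×J ∘ τ) k ∘ₜ ⟪ comparisonAt τ ⟫) ∘ₜ ⟪ cmpI ⟫
      ≡⟨ cong (_∘ₜ ⟪ cmpI ⟫) (sym (transposeₜ-reindexHom X τ k)) ⟩
    transposeₜ B' X τ (reindexHom X τ k) ∘ₜ ⟪ cmpI ⟫
      ≡⟨ sym (transposeₜ-natural B' X τ u (reindexHom X τ k) pI) ⟩
    transposeₜ B' X τ' (reindexHom X τ k ∘ₛ u) ∎)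
    where
      pI : (PI.π₀ ∘ τ) ∘ v ≡ PI.π₀ ∘ τ'
      pI = trans (assoc _ _ _) (cong (PI.π₀ ∘_) e)
      pK : (PK.π₀ ∘ (σ×J ∘ τ)) ∘ v ≡ PK.π₀ ∘ (σ×J ∘ τ')
      pK = trans (assoc _ _ _) (cong (PK.π₀ ∘_) (proj₂ (Σ-map u)))
      cmpI = cmp (PI.π₀ ∘ τ) v pI B'
      cmpK = cmp (PK.π₀ ∘ (σ×J ∘ τ)) v pK B

  reindexHom-natural-homMap : ∀ {X X' : Ob[ J ]} (g : Hom[ id ] X X') {L} (τ : Hom L PI.A×B)
                              (k : SliceHom 𝔹 (sliceObj L (σ×J ∘ τ)) (hom B X)) →
                              reindexHom X' τ (homMap B g ∘ₛ k) ≡ homMap B' g ∘ₛ reindexHom X τ k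
  reindexHom-natural-homMap {X} {X'} g τ k = transposeₜ-injective B' (begin
    transposeₜ B' X' τ (reindexHom X' τ (homMap B g ∘ₛ k))
      ≡⟨ transposeₜ-reindexHom X' τ _ ⟩
    transposeₜ B X' (σ×J ∘ τ) (homMap B g ∘ₛ k) ∘ₜ ⟪ comparisonAt τ ⟫
      ≡⟨ cong (_∘ₜ ⟪ comparisonAt τ ⟫) (transposeₜ-natural-homMap B g (σ×J ∘ τ) k) ⟩
    (⟪ g ⟫ ∘ₜ transposeₜ B X (σ×J ∘ τ) k) ∘ₜ ⟪ comparisonAt τ ⟫
      ≡⟨ assocₜ _ _ _ ⟩
    ⟪ g ⟫ ∘ₜ (transposeₜ B X (σ×J ∘ τ) k ∘ₜ ⟪ comparisonAt τ ⟫)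
      ≡⟨ cong (⟪ g ⟫ ∘ₜ_) (sym (transposeₜ-reindexHom X τ k)) ⟩
    ⟪ g ⟫ ∘ₜ transposeₜ B' X τ (reindexHom X τ k)
      ≡⟨ sym (transposeₜ-natural-homMap B' g τ _) ⟩
    transposeₜ B' X' τ (homMap B' g ∘ₛ reindexHom X τ k) ∎)

  hom-reindex-≅ : NaturalIso (pullbackFunctor 𝔹 (LCCC.pullbacks lcc) σ×J ∘F homFunctor prods fib ls B J)
                             (homFunctor prods fib ls B' J)
  hom-reindex-≅ = homNaturalIso⇒naturalIso (record
    { θ           = λ X {Z} k → reindexHom X (arr Z) (Σ-untranspose (hom B X) k)
    ; θ⁻¹         = λ X {Z} h → Σ-transpose (hom B X) (reindexHom⁻¹ X (arr Z) h)
    ; θ⁻¹∘θ       = λ X {Z} k →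
        trans (cong (Σ-transpose (hom B X)) (reindexHom⁻¹∘reindexHom X (arr Z) _))
              (Σ-transpose∘untranspose (hom B X) k)
    ; θ∘θ⁻¹       = λ X {Z} h →
        trans (cong (reindexHom X (arr Z)) (Σ-untranspose∘transpose (hom B X) _))
              (reindexHom∘reindexHom⁻¹ X (arr Z) h)
    ; θ-natural   = λ X {Z} k u →
        trans (cong (reindexHom X _) (Σ-untranspose-natural (hom B X) k u))
              (reindexHom-natural X (arr Z) u _)
    ; θ-natural-F = λ g {Z} k →
        trans (cong (reindexHom _ (arr Z)) (Σ-untranspose-natural-f^* (homMap B g) k))
              (reindexHom-natural-homMap g (arr Z) _)
    })

mainTheorem11 : ∀ {o ℓ o' ℓ' : Level} (𝔹 : Category o ℓ) (lcc : LCCC 𝔹)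
    (𝔼 : Displayed 𝔹 o' ℓ') (fib : Fibration 𝔼)
    (ls : LocallySmall (LCCC.products lcc) fib)
    {I K : Category.Obj 𝔹} (J : Category.Obj 𝔹)
    (B : Displayed.Ob[_] 𝔼 K)
    → TinyRelTo (LCCC.products lcc) fib ls J B
    → (σ : Category.Hom 𝔹 I K) (B' : Displayed.Ob[_] 𝔼 I)
      (c : Displayed.Hom[_] 𝔼 σ B' B)
    → Displayed.IsCartesian 𝔼 c
    → TinyRelTo (LCCC.products lcc) fib ls J B'
mainTheorem11 𝔹 lcc 𝔼 fib ls J B tiny σ B' c c-cartesian =
  homBijection⇒rightAdjoint
    (homBijection-transfer
      (homBijection-∘ (rightAdjoint⇒homBijection tiny) (rightAdjoint⇒homBijection (LCCC.Π lcc σ×J)))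
      hom-reindex-≅)
  where open HomAlongCartesian lcc ls J c-cartesian
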